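{- Over the ternary alphabet $\{0,1,2\}$, there are uncountably many infinite words that are overlap-free and are the concatenation of (an infinite sequence of) square words.
   Context: A square is a finite word of the form $xx$ with $x$ a nonempty word. An overlap is a word of the form $axaxa$ where $a$ is a single letter and $x$ a possibly empty word. An infinite word is overlap-free if none of its finite factors (contiguous subwords) is an overlap. -}

module Defs where

open import Data.Nat using (ℕ; zero; suc; _+_; _∸_; _<_)
open import Data.Fin using (Fin)
open import Data.List using (List; []; _∷_; _++_; [_]; map; upTo)
open import Data.Product using (Σ; ∃; _×_; ∃-syntax)
open import Relation.Nullary using (¬_)
open import Relation.Binary.PropositionalEquality using (_≡_; _≢_)

Letter : Set
Letter = Fin 3

FinWord : Set
FinWord = List Letter

InfWord : Set
InfWord = ℕ → Letter

factor : InfWord → ℕ → ℕ → FinWord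
factor w i n = map (λ k → w (i + k)) (upTo n)

IsSquare : FinWord → Set
IsSquare u = ∃[ x ] (x ≢ [] × u ≡ x ++ x)

IsOverlap : FinWord → Set
IsOverlap u = ∃[ a ] ∃[ x ] (u ≡ a ∷ x ++ a ∷ x ++ [ a ])

OverlapFree : InfWord → Set
OverlapFree w = ∀ i n → ¬ IsOverlap (factor w i n)

-- w is the concatenation of an infinite sequence of squares:
-- w = s₀ s₁ s₂ ... with each sᵢ a square; sₖ occupies positions [p k, p (suc k)).
SquareConcat : InfWord → Set
SquareConcat w =
  Σ (ℕ → ℕ) λ p →
    p 0 ≡ 0 × (∀ k → p k < p (suc k) × IsSquare (factor w (p k) (p (suc k) ∸ p k)))

Good : InfWord → Set
Good w = OverlapFree w × SquareConcat w

Apart : InfWord → InfWord → Set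
Apart v w = ∃[ i ] (v i ≢ w i)

-- Uncountability (constructive, Cantor-style): no sequence of words
-- enumerates the set, witnessed by an element apart from every listed word.
Uncountable : (InfWord → Set) → Set
Uncountable P = (f : ℕ → InfWord) → ∃[ w ] (P w × (∀ n → Apart w (f n)))

-- For s : ℕ → Bool let limit s be the limit of h (s 0) (h (s 1) (⋯ h (s n) (000⋯))), where h false and
-- h true are two 13-uniform morphisms of {0,1,2}.  Every limit s is square-free, by induction on the
-- period p of a square.  If p ≤ 25, the square lies in the image of a factor of length 5 of
-- limit (s ∘ suc), which is square-free, and h b maps square-free words of length 5 to square-free
-- words.  If p ≥ 26, the square contains a whole block h b c, and since h b c never occurs at a
-- position that is not a multiple of 13, 13 ∣ p; as h b a ends with a, the square then descends to
-- a square of period p / 13 in limit (s ∘ suc).  These finite facts about h are checked exhaustively.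
-- Doubling every letter of a square-free word gives an overlap-free word that is a product of the
-- squares aa.  The letter of limit s at 13 ^ n is 1 or 2 according to s n, so choosing s n against
-- the n-th word of a given sequence diagonalises out of it.

module Submission where

open import Data.Bool using (Bool; true; false)
open import Data.Empty using (⊥; ⊥-elim)
open import Data.Fin using (Fin; zero; suc; toℕ; fromℕ)
open import Data.Fin.Patterns using (0F; 1F; 2F)
open import Data.Fin.Properties using (all?; fromℕ<-cong; fromℕ<-toℕ; toℕ<n) renaming (_≟_ to _≟ᶠ_)
open import Data.List using ([]; _∷_; _++_; [_]; applyUpTo; upTo; length)
open import Data.List.Properties using (length-map; length-upTo; length-++; map-applyUpTo)
open import Data.Maybe using (Maybe; just; nothing)
open import Data.Maybe.Properties using (just-injective)
open import Data.Nat
  using ( ℕ; zero; suc; _+_; _*_; _∸_; _^_; _/_; _%_; _≤_; _<_; _≤?_; _<?_; z≤n; s≤s; s≤s⁻¹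
        ; ⌊_/2⌋; ⌈_/2⌉; >-nonZero)
open import Data.Nat.DivMod
open import Data.Nat.Divisibility using (_∣_; n∣m*n; m%n≡0⇒n∣m)
open import Data.Nat.Induction using (<-rec)
open import Data.Nat.Properties
open import Data.Nat.Tactic.RingSolver using (solve-∀)
open import Data.Product using (_×_; _,_; ∃)
open import Data.Sum using (_⊎_; inj₁; inj₂)
open import Data.Vec using (Vec; []; _∷_; lookup)
open import Function using (_∘_; const)
open import Relation.Binary.PropositionalEquality
  using (_≡_; _≢_; _≗_; refl; sym; trans; cong; cong₂; subst; module ≡-Reasoning)
open import Relation.Nullary using (Dec; yes; no; does; ¬_; ¬?; _→-dec_; map′)
open import Relation.Nullary.Decidable using (from-yes)
open import Defs

variable
  m n p i : ℕ
  u v w : InfWord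

-- Prefixes, squares and overlaps of infinite words

infixr 5 _∷ʷ_

_∷ʷ_ : Letter → InfWord → InfWord
(a ∷ʷ u) zero    = a
(a ∷ʷ u) (suc k) = u k

∷ʷ-η : ∀ u → u 0 ∷ʷ (u ∘ suc) ≗ u
∷ʷ-η u zero    = refl
∷ʷ-η u (suc k) = refl

drop : ℕ → InfWord → InfWord
drop i w k = w (i + k)

drop-drop : ∀ i j w → drop j (drop i w) ≗ drop (i + j) w
drop-drop i j w k = cong w (sym (+-assoc i j k))

Agree : ℕ → InfWord → InfWord → Set
Agree n u v = ∀ {k} → k < n → u k ≡ v k

agree? : ∀ n u v → Dec (Agree n u v)
agree? n u v = allUpTo? (λ k → u k ≟ᶠ v k) n

≗⇒agree : u ≗ v → Agree n u v
≗⇒agree u≗v {k} _ = u≗v k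

agree-sym : Agree n u v → Agree n v u
agree-sym uv k<n = sym (uv k<n)

agree-trans : Agree n u v → Agree n v w → Agree n u w
agree-trans uv vw k<n = trans (uv k<n) (vw k<n)

agree-mono : m ≤ n → Agree n u v → Agree m u v
agree-mono m≤n uv k<m = uv (<-≤-trans k<m m≤n)

agree-drop : ∀ m → Agree (m + n) u v → Agree n (drop m u) (drop m v)
agree-drop m uv k<n = uv (+-monoʳ-< m k<n)

agree-head : ∀ u → Agree 1 u (const (u 0))
agree-head u {zero}  _         = refl
agree-head u {suc k} (s≤s ())

∷ʷ-agree : ∀ a → Agree n u v → Agree (suc n) (a ∷ʷ u) (a ∷ʷ v)
∷ʷ-agree a uv {zero}  _         = refl
∷ʷ-agree a uv {suc k} (s≤s k<n) = uv k<n

SquarePrefix : ℕ → InfWord → Set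
SquarePrefix p u = Agree p u (drop p u)

OverlapPrefix : ℕ → InfWord → Set
OverlapPrefix p u = Agree (suc p) u (drop p u)

SquareFreePrefix : ℕ → InfWord → Set
SquareFreePrefix n u = ∀ j p → 0 < p → j + (p + p) ≤ n → ¬ SquarePrefix p (drop j u)

SquareFree : InfWord → Set
SquareFree w = ∀ i p → 0 < p → ¬ SquarePrefix p (drop i w)

squarePrefix-agree : Agree (p + p) u v → SquarePrefix p u → SquarePrefix p v
squarePrefix-agree {p} uv sq k<p =
  trans (sym (uv (<-≤-trans k<p (m≤m+n p p)))) (trans (sq k<p) (uv (+-monoʳ-< p k<p)))

squareFreePrefix-agree : Agree n u v → SquareFreePrefix n u → SquareFreePrefix n v
squareFreePrefix-agree uv sf j p 0<p le sq =
  sf j p 0<p le (squarePrefix-agree (agree-sym (agree-drop j (agree-mono le uv))) sq)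

squareFreePrefix-drop : ∀ r → r + m ≤ n → SquareFreePrefix n u → SquareFreePrefix m (drop r u)
squareFreePrefix-drop {u = u} r le sf j p 0<p le′ sq =
  sf (r + j) p 0<p (≤-trans (≤-reflexive (+-assoc r j _)) (≤-trans (+-monoʳ-≤ r le′) le))
     (squarePrefix-agree (≗⇒agree (drop-drop r j u)) sq)

squareFreePrefix-1 : ∀ u → SquareFreePrefix 1 u
squareFreePrefix-1 u j p 0<p le with ≤-trans (+-mono-≤ 0<p 0<p) (≤-trans (m≤n+m (p + p) j) le)
... | s≤s ()

squareFree-adjacent : SquareFree w → ∀ x → w x ≢ w (suc x)
squareFree-adjacent {w} sf x eq = sf x 1 (s≤s z≤n) square
  where
  square : SquarePrefix 1 (drop x w)
  square {zero}  _         = trans (cong w (+-identityʳ x)) (trans eq (cong w (+-comm 1 x)))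
  square {suc k} (s≤s ())

squarePrefix? : ∀ p u → Dec (SquarePrefix p u)
squarePrefix? p u = agree? p u (drop p u)

-- Quantifying over p first bounds j by n ∸ (p + p), which keeps the exhaustive checks below fast.
squareFreePrefix? : ∀ n u → Dec (SquareFreePrefix n u)
squareFreePrefix? n u = map′ sound complete (allUpTo? noSquareOfPeriod? n)
  where
  NoSquareOfPeriod : ℕ → Set
  NoSquareOfPeriod p = 0 < p → p + p ≤ n → ∀ {j} → j < suc (n ∸ (p + p)) → ¬ SquarePrefix p (drop j u)

  noSquareOfPeriod? : ∀ p → Dec (NoSquareOfPeriod p)
  noSquareOfPeriod? p =
    0 <? p →-dec p + p ≤? n →-dec allUpTo? (λ j → ¬? (squarePrefix? p (drop j u))) (suc (n ∸ (p + p)))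

  sound : (∀ {p} → p < n → NoSquareOfPeriod p) → SquareFreePrefix n u
  sound sf j p 0<p le = sf (<-≤-trans (m<m+n p 0<p) 2p≤n) 0<p 2p≤n (s≤s (m+n≤o⇒m≤o∸n j le))
    where 2p≤n = ≤-trans (m≤n+m (p + p) j) le

  complete : SquareFreePrefix n u → ∀ {p} → p < n → NoSquareOfPeriod p
  complete sf {p} _ 0<p 2p≤n {j} (s≤s j≤) = sf j p 0<p (m≤o∸n⇒m+n≤o j 2p≤n j≤)

∀-prefix? : {P : InfWord → Set} → ∀ n → (∀ {u v} → Agree n u v → P u → P v) →
            (∀ u → Dec (P u)) → Dec (∀ u → P u)
∀-prefix? zero resp P? = map′ (λ P0 u → resp (λ ()) P0) (λ all → all (const 0F)) (P? (const 0F))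
∀-prefix? (suc n) resp P? =
  map′ (λ all u → resp (≗⇒agree (∷ʷ-η u)) (all (u 0) (u ∘ suc))) (λ all a v → all (a ∷ʷ v))
       (all? λ a → ∀-prefix? n (resp ∘ ∷ʷ-agree a) (λ v → P? (a ∷ʷ v)))

infixl 9 _!_

_!_ : FinWord → ℕ → Maybe Letter
[]      ! _     = nothing
(a ∷ x) ! zero  = just a
(a ∷ x) ! suc k = x ! k

!-++ˡ : ∀ x {y k} → k < length x → (x ++ y) ! k ≡ x ! k
!-++ˡ (a ∷ x) {k = zero}  _         = refl
!-++ˡ (a ∷ x) {k = suc k} (s≤s k<n) = !-++ˡ x k<n

!-++ʳ : ∀ x {y} k → (x ++ y) ! (length x + k) ≡ y ! k
!-++ʳ []      k = refl
!-++ʳ (a ∷ x) k = !-++ʳ x k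

applyUpTo-! : ∀ (f : ℕ → Letter) {n k} → k < n → applyUpTo f n ! k ≡ just (f k)
applyUpTo-! f {suc n} {zero}  _         = refl
applyUpTo-! f {suc n} {suc k} (s≤s k<n) = applyUpTo-! (f ∘ suc) k<n

factor-! : ∀ w i {n k} → k < n → factor w i n ! k ≡ just (w (i + k))
factor-! w i {n} k<n = trans (cong (_! _) (map-applyUpTo _ _ n)) (applyUpTo-! _ k<n)

overlap-period-! : ∀ a x {k} → let y = a ∷ x in
            k < suc (length y) → (y ++ y ++ [ a ]) ! k ≡ (y ++ y ++ [ a ]) ! (length y + k)
overlap-period-! a x {k} k≤ℓ with m≤n⇒m<n∨m≡n (s≤s⁻¹ k≤ℓ)
... | inj₁ k<ℓ = trans (!-++ˡ y k<ℓ) (sym (trans (!-++ʳ y k) (!-++ˡ y k<ℓ)))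
  where y = a ∷ x
... | inj₂ refl = begin
  (y ++ y ++ [ a ]) ! ℓ              ≡⟨ cong ((y ++ y ++ [ a ]) !_) (sym (+-identityʳ ℓ)) ⟩
  (y ++ y ++ [ a ]) ! (ℓ + 0)        ≡⟨ !-++ʳ y 0 ⟩
  just a                             ≡⟨ sym (!-++ʳ y 0) ⟩
  (y ++ [ a ]) ! (ℓ + 0)             ≡⟨ cong ((y ++ [ a ]) !_) (+-identityʳ ℓ) ⟩
  (y ++ [ a ]) ! ℓ                   ≡⟨ sym (!-++ʳ y ℓ) ⟩
  (y ++ y ++ [ a ]) ! (ℓ + ℓ)        ∎
  where
  open ≡-Reasoning
  y = a ∷ x
  ℓ = length y

isOverlap⇒overlapPrefix : IsOverlap (factor w i n) → ∃ λ p → 0 < p × OverlapPrefix p (drop i w)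
isOverlap⇒overlapPrefix {w} {i} {n} (a , x , eq) = ℓ , s≤s z≤n , period
  where
  y = a ∷ x
  ℓ = length y
  n≡ : n ≡ ℓ + suc ℓ
  n≡ = begin
    n                                  ≡⟨ sym (length-upTo n) ⟩
    length (upTo n)                    ≡⟨ sym (length-map _ (upTo n)) ⟩
    length (factor w i n)              ≡⟨ cong length eq ⟩
    length (y ++ y ++ [ a ])           ≡⟨ length-++ y ⟩
    ℓ + length (y ++ [ a ])            ≡⟨ cong (ℓ +_) (trans (length-++ y) (+-comm ℓ 1)) ⟩
    ℓ + suc ℓ                          ∎
    where open ≡-Reasoning
  period : OverlapPrefix ℓ (drop i w)
  period {k} k≤ℓ = just-injective (begin
    just (w (i + k))                   ≡⟨ sym (factor-! w i k<n) ⟩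
    factor w i n ! k                   ≡⟨ cong (_! k) eq ⟩
    (y ++ y ++ [ a ]) ! k              ≡⟨ overlap-period-! a x k≤ℓ ⟩
    (y ++ y ++ [ a ]) ! (ℓ + k)        ≡⟨ cong (_! (ℓ + k)) (sym eq) ⟩
    factor w i n ! (ℓ + k)             ≡⟨ factor-! w i ℓ+k<n ⟩
    just (w (i + (ℓ + k)))             ∎)
    where
    open ≡-Reasoning
    ℓ+k<n : ℓ + k < n
    ℓ+k<n = subst (ℓ + k <_) (sym n≡) (+-monoʳ-< ℓ k≤ℓ)
    k<n : k < n
    k<n = ≤-<-trans (m≤n+m k ℓ) ℓ+k<n

-- Doubling every letter

double : InfWord → InfWord
double w j = w ⌊ j /2⌋

⌊m+[n+n]/2⌋≡⌊m/2⌋+n : ∀ m n → ⌊ m + (n + n) /2⌋ ≡ ⌊ m /2⌋ + n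
⌊m+[n+n]/2⌋≡⌊m/2⌋+n m zero    = trans (cong ⌊_/2⌋ (+-identityʳ m)) (sym (+-identityʳ ⌊ m /2⌋))
⌊m+[n+n]/2⌋≡⌊m/2⌋+n m (suc n) = begin
  ⌊ m + (suc n + suc n) /2⌋      ≡⟨ cong ⌊_/2⌋ (two-more m n) ⟩
  suc ⌊ m + (n + n) /2⌋          ≡⟨ cong suc (⌊m+[n+n]/2⌋≡⌊m/2⌋+n m n) ⟩
  suc (⌊ m /2⌋ + n)              ≡⟨ sym (+-suc ⌊ m /2⌋ n) ⟩
  ⌊ m /2⌋ + suc n                ∎
  where
  open ≡-Reasoning
  two-more : ∀ m n → m + (suc n + suc n) ≡ 2 + (m + (n + n))
  two-more = solve-∀

⌈n/2⌉≡⌊n/2⌋⊎1+⌊n/2⌋ : ∀ n → ⌈ n /2⌉ ≡ ⌊ n /2⌋ ⊎ ⌈ n /2⌉ ≡ suc ⌊ n /2⌋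
⌈n/2⌉≡⌊n/2⌋⊎1+⌊n/2⌋ zero          = inj₁ refl
⌈n/2⌉≡⌊n/2⌋⊎1+⌊n/2⌋ (suc zero)    = inj₂ refl
⌈n/2⌉≡⌊n/2⌋⊎1+⌊n/2⌋ (suc (suc n)) with ⌈n/2⌉≡⌊n/2⌋⊎1+⌊n/2⌋ n
... | inj₁ eq = inj₁ (cong suc eq)
... | inj₂ eq = inj₂ (cong suc eq)

double-shift : ∀ w i n → double w (i + (n + n)) ≡ w (⌊ i /2⌋ + n)
double-shift w i n = cong w (⌊m+[n+n]/2⌋≡⌊m/2⌋+n i n)

double-squareConcat : ∀ w → SquareConcat (double w)
double-squareConcat w = (λ k → k + k) , refl , λ k → k+k<next k , square k
  where
  next≡ : ∀ k → suc k + suc k ≡ 2 + (k + k)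
  next≡ k = cong suc (+-suc k k)
  k+k<next : ∀ k → k + k < suc k + suc k
  k+k<next k = subst (k + k <_) (sym (next≡ k)) (m<n+m (k + k) {2} (s≤s z≤n))
  square : ∀ k → IsSquare (factor (double w) (k + k) (suc k + suc k ∸ (k + k)))
  square k rewrite next≡ k | m+n∸n≡m 2 (k + k) =
    [ w k ] , (λ ()) , cong₂ (λ a b → a ∷ b ∷ []) (letter 0) (letter 1)
    where
    letter : ∀ r → double w (k + k + r) ≡ w (⌊ r /2⌋ + k)
    letter r = trans (cong (double w) (+-comm (k + k) r)) (double-shift w r k)

double-overlap-even : ∀ q → OverlapPrefix (q + q) (drop i (double w)) → SquarePrefix q (drop ⌊ i /2⌋ w)
double-overlap-even {i} {w} q per {k} k<q = begin
  w (⌊ i /2⌋ + k)                      ≡⟨ sym (double-shift w i k) ⟩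
  double w (i + (k + k))               ≡⟨ per (s≤s (+-mono-≤ (<⇒≤ k<q) (<⇒≤ k<q))) ⟩
  double w (i + ((q + q) + (k + k)))   ≡⟨ cong (λ x → double w (i + x)) (interchange q k) ⟩
  double w (i + ((q + k) + (q + k)))   ≡⟨ double-shift w i (q + k) ⟩
  w (⌊ i /2⌋ + (q + k))                ∎
  where
  open ≡-Reasoning
  interchange : ∀ q k → (q + q) + (k + k) ≡ (q + k) + (q + k)
  interchange = solve-∀

double-overlap-odd : ∀ q → OverlapPrefix (q + suc q) (drop i (double w)) → ∃ λ x → w x ≡ w (suc x)
double-overlap-odd {i} {w} q per = adjacent (⌈n/2⌉≡⌊n/2⌋⊎1+⌊n/2⌋ i)
  where
  open ≡-Reasoning
  -- w a and w b are the letters at positions i and i + 1 of double w.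
  a = ⌊ i /2⌋
  b = ⌈ i /2⌉
  first : w (a + 0) ≡ w (b + q)
  first = begin
    w (a + 0)                      ≡⟨ sym (double-shift w i 0) ⟩
    double w (i + 0)               ≡⟨ per (s≤s z≤n) ⟩
    double w (i + (q + suc q + 0)) ≡⟨ cong (double w) (e i q) ⟩
    double w (suc i + (q + q))     ≡⟨ double-shift w (suc i) q ⟩
    w (b + q)                      ∎
    where
    e : ∀ i q → i + (q + suc q + 0) ≡ suc i + (q + q)
    e = solve-∀
  second : w (b + 0) ≡ w (a + suc q)
  second = begin
    w (b + 0)                      ≡⟨ sym (double-shift w (suc i) 0) ⟩
    double w (suc i + 0)           ≡⟨ cong (double w) (trans (+-identityʳ (suc i)) (+-comm 1 i)) ⟩
    double w (i + 1)               ≡⟨ per (s≤s (≤-trans (s≤s z≤n) (m≤n+m (suc q) q))) ⟩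
    double w (i + (q + suc q + 1)) ≡⟨ cong (double w) (e i q) ⟩
    double w (i + (suc q + suc q)) ≡⟨ double-shift w i (suc q) ⟩
    w (a + suc q)                  ∎
    where
    e : ∀ i q → i + (q + suc q + 1) ≡ i + (suc q + suc q)
    e = solve-∀
  adjacent : b ≡ a ⊎ b ≡ suc a → ∃ λ x → w x ≡ w (suc x)
  adjacent (inj₁ b≡a) = a + q , (begin
    w (a + q)           ≡⟨ cong (λ b → w (b + q)) (sym b≡a) ⟩
    w (b + q)           ≡⟨ sym first ⟩
    w (a + 0)           ≡⟨ cong (λ b → w (b + 0)) (sym b≡a) ⟩
    w (b + 0)           ≡⟨ second ⟩
    w (a + suc q)       ≡⟨ cong w (+-suc a q) ⟩
    w (suc (a + q))     ∎)
  adjacent (inj₂ b≡1+a) = a , (begin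
    w a                 ≡⟨ cong w (sym (+-identityʳ a)) ⟩
    w (a + 0)           ≡⟨ first ⟩
    w (b + q)           ≡⟨ cong (λ b → w (b + q)) b≡1+a ⟩
    w (suc a + q)       ≡⟨ cong w (sym (+-suc a q)) ⟩
    w (a + suc q)       ≡⟨ sym second ⟩
    w (b + 0)           ≡⟨ cong (λ b → w (b + 0)) b≡1+a ⟩
    w (suc a + 0)       ≡⟨ cong w (+-identityʳ (suc a)) ⟩
    w (suc a)           ∎)

double-overlapFree : ∀ w → SquareFree w → OverlapFree (double w)
double-overlapFree w sf i n ov with isOverlap⇒overlapPrefix {w = double w} {i} {n} ov
... | p , 0<p , per = parity (⌈n/2⌉≡⌊n/2⌋⊎1+⌊n/2⌋ p)
  where
  q = ⌊ p /2⌋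
  p≡ : ∀ {r} → ⌈ p /2⌉ ≡ r → p ≡ q + r
  p≡ eq = trans (sym (⌊n/2⌋+⌈n/2⌉≡n p)) (cong (q +_) eq)
  periodic : ∀ {r} → ⌈ p /2⌉ ≡ r → OverlapPrefix (q + r) (drop i (double w))
  periodic eq = subst (λ p → OverlapPrefix p (drop i (double w))) (p≡ eq) per
  positive : ∀ {q} → 0 < q + q → 0 < q
  positive {zero}  ()
  positive {suc _} _ = s≤s z≤n
  parity : ⌈ p /2⌉ ≡ q ⊎ ⌈ p /2⌉ ≡ suc q → ⊥
  parity (inj₁ eq) =
    sf ⌊ i /2⌋ q (positive (subst (0 <_) (p≡ eq) 0<p)) (double-overlap-even {i} {w} q (periodic eq))
  parity (inj₂ eq) =
    let x , wx≡wx+1 = double-overlap-odd {i} {w} q (periodic eq) in squareFree-adjacent {w} sf x wx≡wx+1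

-- 13-uniform morphisms

Morphism : Set
Morphism = Letter → Vec Letter 13

infix 8 _⟨_⟩

_⟨_⟩ : Morphism → InfWord → InfWord
(σ ⟨ u ⟩) m = lookup (σ (u (m / 13))) (m mod 13)

i≡i/13*13+i%13 : ∀ i → i ≡ i / 13 * 13 + i % 13
i≡i/13*13+i%13 i = trans (m≡m%n+[m/n]*n i 13) (+-comm (i % 13) _)

i+[m∸i%13]≡i/13*13+m : ∀ i → i % 13 ≤ m → i + (m ∸ i % 13) ≡ i / 13 * 13 + m
i+[m∸i%13]≡i/13*13+m {m} i r≤m = begin
  i + (m ∸ r)                      ≡⟨ cong (_+ (m ∸ r)) (i≡i/13*13+i%13 i) ⟩
  i / 13 * 13 + r + (m ∸ r)        ≡⟨ +-assoc (i / 13 * 13) r (m ∸ r) ⟩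
  i / 13 * 13 + (r + (m ∸ r))      ≡⟨ cong (i / 13 * 13 +_) (m+[n∸m]≡n r≤m) ⟩
  i / 13 * 13 + m                  ∎
  where
  open ≡-Reasoning
  r = i % 13

image-agree : ∀ σ → Agree n u v → Agree (n * 13) (σ ⟨ u ⟩) (σ ⟨ v ⟩)
image-agree σ uv {k} k<n*13 = cong (λ a → lookup (σ a) (k mod 13)) (uv (m<n*o⇒m/o<n k<n*13))

image-drop : ∀ σ q u → drop (q * 13) (σ ⟨ u ⟩) ≗ σ ⟨ drop q u ⟩
image-drop σ q u m = cong₂ (λ a r → lookup (σ (u a)) r) quotient remainder
  where
  quotient : (q * 13 + m) / 13 ≡ q + m / 13
  quotient = trans (+-distrib-/-∣ˡ m (n∣m*n q)) (cong (_+ m / 13) (m*n/n≡m q 13))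
  remainder : (q * 13 + m) mod 13 ≡ m mod 13
  remainder = fromℕ<-cong _ _ (%-remove-+ˡ m (n∣m*n q)) _ _

drop-image : ∀ σ u i → drop i (σ ⟨ u ⟩) ≗ drop (i % 13) (σ ⟨ drop (i / 13) u ⟩)
drop-image σ u i k = trans (cong (σ ⟨ u ⟩) position) (image-drop σ (i / 13) u (i % 13 + k))
  where
  position : i + k ≡ i / 13 * 13 + (i % 13 + k)
  position = trans (cong (_+ k) (i≡i/13*13+i%13 i)) (+-assoc (i / 13 * 13) (i % 13) k)

image-block : ∀ σ u q (r : Fin 13) → (σ ⟨ u ⟩) (q * 13 + toℕ r) ≡ lookup (σ (u q)) r
image-block σ u q r =
  trans (image-drop σ q u (toℕ r)) (cong₂ (λ a r → lookup (σ (u a)) r) quotient remainder)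
  where
  quotient : q + toℕ r / 13 ≡ q
  quotient = trans (cong (q +_) (m<n⇒m/n≡0 (toℕ<n r))) (+-identityʳ q)
  remainder : toℕ r mod 13 ≡ r
  remainder = trans (fromℕ<-cong _ _ (m<n⇒m%n≡m (toℕ<n r)) _ (toℕ<n r)) (fromℕ<-toℕ r _)

PreservesSquareFree : Morphism → ℕ → Set
PreservesSquareFree σ n = ∀ u → SquareFreePrefix n u → SquareFreePrefix (n * 13) (σ ⟨ u ⟩)

preservesSquareFree? : ∀ σ n → Dec (PreservesSquareFree σ n)
preservesSquareFree? σ n =
  ∀-prefix? n respects λ u → squareFreePrefix? n u →-dec squareFreePrefix? (n * 13) (σ ⟨ u ⟩)
  where
  respects : Agree n u v → (SquareFreePrefix n u → SquareFreePrefix (n * 13) (σ ⟨ u ⟩)) →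
             SquareFreePrefix n v → SquareFreePrefix (n * 13) (σ ⟨ v ⟩)
  respects {u} {v} uv pres sf =
    squareFreePrefix-agree {v = σ ⟨ v ⟩} (image-agree σ uv)
      (pres (squareFreePrefix-agree {v = u} (agree-sym uv) sf))

image-squareFreeFactor : ∀ σ i → PreservesSquareFree σ n → SquareFreePrefix n (drop (i / 13) u) →
                         i % 13 + m ≤ n * 13 → SquareFreePrefix m (drop i (σ ⟨ u ⟩))
image-squareFreeFactor {u = u} σ i pres sf le =
  squareFreePrefix-agree {v = drop i (σ ⟨ u ⟩)} (≗⇒agree (sym ∘ drop-image σ u i))
    (squareFreePrefix-drop {u = σ ⟨ drop (i / 13) u ⟩} (i % 13) le (pres (drop (i / 13) u) sf))

-- σ ⟨ const c ⟩ begins with the block σ c.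
NoShiftedBlock : Morphism → InfWord → Set
NoShiftedBlock σ u = ∀ c {r} → r < 13 → 0 < r → ¬ Agree 13 (drop r (σ ⟨ u ⟩)) (σ ⟨ const c ⟩)

LocallySynchronizing : Morphism → Set
LocallySynchronizing σ = ∀ u → SquareFreePrefix 2 u → NoShiftedBlock σ u

locallySynchronizing? : ∀ σ → Dec (LocallySynchronizing σ)
locallySynchronizing? σ = ∀-prefix? 2 respects λ u → squareFreePrefix? 2 u →-dec all? λ c →
  allUpTo? (λ r → 0 <? r →-dec ¬? (agree? 13 (drop r (σ ⟨ u ⟩)) (σ ⟨ const c ⟩))) 13
  where
  respects : Agree 2 u v → (SquareFreePrefix 2 u → NoShiftedBlock σ u) →
             SquareFreePrefix 2 v → NoShiftedBlock σ v
  respects {u} {v} uv sync sf c {r} r<13 0<r occ =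
    sync (squareFreePrefix-agree {v = u} (agree-sym uv) sf) c r<13 0<r (agree-trans images occ)
    where
    images : Agree 13 (drop r (σ ⟨ u ⟩)) (drop r (σ ⟨ v ⟩))
    images = agree-drop r (agree-mono (+-monoˡ-≤ 13 (<⇒≤ r<13)) (image-agree σ uv))

-- A square of period p ≥ 26 contains a whole block σ c of σ u, starting at J; its copy starts p % 13
-- letters into a block of σ u, which local synchronization forbids unless 13 ∣ p.
square-period-divisible : ∀ σ → LocallySynchronizing σ → (∀ q → SquareFreePrefix 2 (drop q u)) →
                          26 ≤ p → SquarePrefix p (drop i (σ ⟨ u ⟩)) → 13 ∣ p
square-period-divisible {u} {p} {i} σ sync sf₂ 26≤p sq with p % 13 in p%13≡
... | zero  = m%n≡0⇒n∣m p 13 p%13≡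
... | suc _ = ⊥-elim (sync (drop q′ u) (sf₂ q′) (u (suc q + 0)) (m%n<n (J + p) 13) 0<r copy)
  where
  open ≡-Reasoning
  q = i / 13
  J = suc q * 13
  d = 13 ∸ i % 13
  q′ = (J + p) / 13
  r = (J + p) % 13
  0<r : 0 < r
  0<r = subst (0 <_) (sym (trans (%-remove-+ˡ p (n∣m*n (suc q))) p%13≡)) (s≤s z≤n)
  i+d≡J : i + d ≡ J
  i+d≡J = trans (i+[m∸i%13]≡i/13*13+m i (<⇒≤ (m%n<n i 13))) (+-comm (q * 13) 13)
  shuffle : ∀ i d p k → i + (p + (d + k)) ≡ i + d + p + k
  shuffle = solve-∀
  copy : Agree 13 (drop r (σ ⟨ drop q′ u ⟩)) (σ ⟨ const (u (suc q + 0)) ⟩)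
  copy {k} k<13 = begin
    drop r (σ ⟨ drop q′ u ⟩) k           ≡⟨ sym (drop-image σ u (J + p) k) ⟩
    (σ ⟨ u ⟩) (J + p + k)                ≡⟨ cong (λ x → (σ ⟨ u ⟩) (x + p + k)) (sym i+d≡J) ⟩
    (σ ⟨ u ⟩) (i + d + p + k)            ≡⟨ cong (σ ⟨ u ⟩) (sym (shuffle i d p k)) ⟩
    (σ ⟨ u ⟩) (i + (p + (d + k)))        ≡⟨ sym (sq d+k<p) ⟩
    (σ ⟨ u ⟩) (i + (d + k))              ≡⟨ cong (σ ⟨ u ⟩) (sym (+-assoc i d k)) ⟩
    (σ ⟨ u ⟩) (i + d + k)                ≡⟨ cong (λ x → (σ ⟨ u ⟩) (x + k)) i+d≡J ⟩
    (σ ⟨ u ⟩) (J + k)                    ≡⟨ image-drop σ (suc q) u k ⟩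
    (σ ⟨ drop (suc q) u ⟩) k             ≡⟨ image-agree σ (agree-head (drop (suc q) u)) k<13 ⟩
    (σ ⟨ const (u (suc q + 0)) ⟩) k      ∎
    where
    d+k<p : d + k < p
    d+k<p = <-≤-trans (+-mono-≤-< (m∸n≤m 13 (i % 13)) k<13) 26≤p

-- Every σ a ends with a, so the letters at the block ends inside the square spell a square of u.
square-desubstitute : ∀ σ → (∀ a → lookup (σ a) (fromℕ 12) ≡ a) →
                      SquarePrefix (p * 13) (drop i (σ ⟨ u ⟩)) → SquarePrefix p (drop (i / 13) u)
square-desubstitute {p} {i} {u} σ last sq {k} k<p = begin
  u (q + k)                                 ≡⟨ sym (last-letter (q + k)) ⟩
  (σ ⟨ u ⟩) ((q + k) * 13 + 12)             ≡⟨ cong (σ ⟨ u ⟩) (position k) ⟩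
  (σ ⟨ u ⟩) (i + (t + k * 13))              ≡⟨ sq t+13k<13p ⟩
  (σ ⟨ u ⟩) (i + (p * 13 + (t + k * 13)))   ≡⟨ cong (λ x → (σ ⟨ u ⟩) (i + x)) (shuffle t p k) ⟩
  (σ ⟨ u ⟩) (i + (t + (p + k) * 13))        ≡⟨ cong (σ ⟨ u ⟩) (sym (position (p + k))) ⟩
  (σ ⟨ u ⟩) ((q + (p + k)) * 13 + 12)       ≡⟨ last-letter (q + (p + k)) ⟩
  u (q + (p + k))                           ∎
  where
  open ≡-Reasoning
  q = i / 13
  t = 12 ∸ i % 13
  t+13k<13p : t + k * 13 < p * 13
  t+13k<13p = <-≤-trans (+-monoˡ-< (k * 13) (s≤s (m∸n≤m 12 (i % 13)))) (*-monoˡ-≤ 13 k<p)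
  last-letter : ∀ j → (σ ⟨ u ⟩) (j * 13 + 12) ≡ u j
  last-letter j = trans (image-block σ u j (fromℕ 12)) (last (u j))
  regroup : ∀ q k → (q + k) * 13 + 12 ≡ q * 13 + 12 + k * 13
  regroup = solve-∀
  shuffle : ∀ t p k → p * 13 + (t + k * 13) ≡ t + (p + k) * 13
  shuffle = solve-∀
  position : ∀ k → (q + k) * 13 + 12 ≡ i + (t + k * 13)
  position k = begin
    (q + k) * 13 + 12        ≡⟨ regroup q k ⟩
    q * 13 + 12 + k * 13     ≡⟨ cong (_+ k * 13) (sym (i+[m∸i%13]≡i/13*13+m i (≤-pred (m%n<n i 13)))) ⟩
    i + t + k * 13           ≡⟨ +-assoc i t (k * 13) ⟩
    i + (t + k * 13)         ∎

h : Bool → Morphism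
h false 0F = 0F ∷ 1F ∷ 2F ∷ 1F ∷ 0F ∷ 2F ∷ 1F ∷ 2F ∷ 0F ∷ 1F ∷ 2F ∷ 1F ∷ 0F ∷ []
h false 1F = 1F ∷ 2F ∷ 0F ∷ 2F ∷ 1F ∷ 0F ∷ 2F ∷ 0F ∷ 1F ∷ 2F ∷ 0F ∷ 2F ∷ 1F ∷ []
h false 2F = 2F ∷ 0F ∷ 1F ∷ 0F ∷ 2F ∷ 1F ∷ 0F ∷ 1F ∷ 2F ∷ 0F ∷ 1F ∷ 0F ∷ 2F ∷ []
h true  0F = 0F ∷ 2F ∷ 1F ∷ 2F ∷ 0F ∷ 1F ∷ 2F ∷ 1F ∷ 0F ∷ 2F ∷ 1F ∷ 2F ∷ 0F ∷ []
h true  1F = 1F ∷ 0F ∷ 2F ∷ 0F ∷ 1F ∷ 2F ∷ 0F ∷ 2F ∷ 1F ∷ 0F ∷ 2F ∷ 0F ∷ 1F ∷ []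
h true  2F = 2F ∷ 1F ∷ 0F ∷ 1F ∷ 2F ∷ 0F ∷ 1F ∷ 0F ∷ 2F ∷ 1F ∷ 0F ∷ 1F ∷ 2F ∷ []

h-first : ∀ b a → lookup (h b a) 0F ≡ a
h-first false 0F = refl
h-first false 1F = refl
h-first false 2F = refl
h-first true  0F = refl
h-first true  1F = refl
h-first true  2F = refl

h-last : ∀ b a → lookup (h b a) (fromℕ 12) ≡ a
h-last false 0F = refl
h-last false 1F = refl
h-last false 2F = refl
h-last true  0F = refl
h-last true  1F = refl
h-last true  2F = refl

h-squareFree₁ : ∀ b → PreservesSquareFree (h b) 1
h-squareFree₁ false = from-yes (preservesSquareFree? (h false) 1)
h-squareFree₁ true  = from-yes (preservesSquareFree? (h true) 1)

h-squareFree₂ : ∀ b → PreservesSquareFree (h b) 2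
h-squareFree₂ false = from-yes (preservesSquareFree? (h false) 2)
h-squareFree₂ true  = from-yes (preservesSquareFree? (h true) 2)

h-squareFree₅ : ∀ b → PreservesSquareFree (h b) 5
h-squareFree₅ false = from-yes (preservesSquareFree? (h false) 5)
h-squareFree₅ true  = from-yes (preservesSquareFree? (h true) 5)

h-locallySynchronizing : ∀ b → LocallySynchronizing (h b)
h-locallySynchronizing false = from-yes (locallySynchronizing? (h false))
h-locallySynchronizing true  = from-yes (locallySynchronizing? (h true))

-- The limit word of a directive sequence

approx : ℕ → (ℕ → Bool) → InfWord
approx zero    s = const 0F
approx (suc n) s = h (s 0) ⟨ approx n (s ∘ suc) ⟩

-- Every h b a begins with a, so approx n s i no longer changes once n > i.
limit : (ℕ → Bool) → InfWord
limit s i = approx (suc i) s i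

approx-head : ∀ n s → approx n s 0 ≡ 0F
approx-head zero    s = refl
approx-head (suc n) s =
  trans (cong (λ a → lookup (h (s 0) a) 0F) (approx-head n (s ∘ suc))) (h-first (s 0) 0F)

approx-stable : ∀ m n s {i} → i ≤ m → i ≤ n → approx m s i ≡ approx n s i
approx-stable m       n       s {zero}       _         _         =
  trans (approx-head m s) (sym (approx-head n s))
approx-stable (suc m) (suc n) s {i@(suc i′)} (s≤s i′≤m) (s≤s i′≤n) =
  cong (λ a → lookup (h (s 0) a) (i mod 13))
       (approx-stable m n (s ∘ suc) (≤-trans q≤i′ i′≤m) (≤-trans q≤i′ i′≤n))
  where
  q≤i′ : i / 13 ≤ i′
  q≤i′ = s≤s⁻¹ (m/n<m i 13 (m≤m+n 2 11))

limit-fixed : ∀ s → limit s ≗ h (s 0) ⟨ limit (s ∘ suc) ⟩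
limit-fixed s i = cong (λ a → lookup (h (s 0) a) (i mod 13))
                       (approx-stable i (suc (i / 13)) (s ∘ suc) (m/n≤m i 13) (n≤1+n _))

limit-head : ∀ s → limit s 0 ≡ 0F
limit-head = approx-head 1

i%13+m≤n : ∀ i → 12 + m ≤ n → i % 13 + m ≤ n
i%13+m≤n {m} i = ≤-trans (+-monoˡ-≤ m (s≤s⁻¹ (m%n<n i 13)))

limit-squareFreeFactor : ∀ s i → PreservesSquareFree (h (s 0)) n →
                         SquareFreePrefix n (drop (i / 13) (limit (s ∘ suc))) →
                         i % 13 + m ≤ n * 13 → SquareFreePrefix m (drop i (limit s))
limit-squareFreeFactor s i pres sf le =
  squareFreePrefix-agree {v = drop i (limit s)} (≗⇒agree (sym ∘ limit-fixed s ∘ (i +_)))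
    (image-squareFreeFactor {u = limit (s ∘ suc)} (h (s 0)) i pres sf le)

limit-squareFreeFactor₂ : ∀ s i → SquareFreePrefix 2 (drop i (limit s))
limit-squareFreeFactor₂ s i = <-rec (λ i → ∀ s → SquareFreePrefix 2 (drop i (limit s))) step i s
  where
  step : ∀ i → (∀ {j} → j < i → ∀ s → SquareFreePrefix 2 (drop j (limit s))) →
         ∀ s → SquareFreePrefix 2 (drop i (limit s))
  -- At i = 0 the block index i / 13 does not decrease, so fall back on the images of single letters.
  step zero    _   s = limit-squareFreeFactor s 0 (h-squareFree₁ (s 0))
                         (squareFreePrefix-1 (drop 0 (limit (s ∘ suc)))) (m≤m+n 2 11)
  step (suc i) rec s = limit-squareFreeFactor s (suc i) (h-squareFree₂ (s 0))
                         (rec (m/n<m (suc i) 13 (m≤m+n 2 11)) (s ∘ suc)) (i%13+m≤n (suc i) (m≤m+n 14 12))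

limit-squareFreeFactor₅ : ∀ s i → SquareFreePrefix 5 (drop i (limit s))
limit-squareFreeFactor₅ s i = limit-squareFreeFactor s i (h-squareFree₂ (s 0))
  (limit-squareFreeFactor₂ (s ∘ suc) (i / 13)) (i%13+m≤n i (m≤m+n 17 9))

limit-squareFree : ∀ s → SquareFree (limit s)
limit-squareFree s i p = <-rec (λ p → ∀ s i → 0 < p → ¬ SquarePrefix p (drop i (limit s))) step p s i
  where
  step : ∀ p → (∀ {p′} → p′ < p → ∀ s i → 0 < p′ → ¬ SquarePrefix p′ (drop i (limit s))) →
         ∀ s i → 0 < p → ¬ SquarePrefix p (drop i (limit s))
  step p rec s i 0<p sq with p ≤? 25
  ... | yes p≤25 = limit-squareFreeFactor {m = p + p} s i (h-squareFree₅ (s 0))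
                     (limit-squareFreeFactor₅ (s ∘ suc) (i / 13)) (i%13+m≤n i 12+2p≤65) 0 p 0<p ≤-refl sq
    where
    12+2p≤65 : 12 + (p + p) ≤ 5 * 13
    12+2p≤65 = ≤-trans (+-monoʳ-≤ 12 (+-mono-≤ p≤25 p≤25)) (m≤m+n 62 3)
  ... | no p≰25 = rec (m/n<m p 13 {{>-nonZero 0<p}} (m≤m+n 2 11)) (s ∘ suc) (i / 13)
                    (m≥n⇒m/n>0 (≤-trans (m≤m+n 13 13) 26≤p))
                    (square-desubstitute {i = i} {u = limit (s ∘ suc)} (h (s 0)) (h-last (s 0)) sq″)
    where
    image = h (s 0) ⟨ limit (s ∘ suc) ⟩
    26≤p : 26 ≤ p
    26≤p = ≰⇒> p≰25
    sq′ : SquarePrefix p (drop i image)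
    sq′ = squarePrefix-agree (≗⇒agree (limit-fixed s ∘ (i +_))) sq
    13∣p : 13 ∣ p
    13∣p = square-period-divisible {limit (s ∘ suc)} {i = i} (h (s 0)) (h-locallySynchronizing (s 0))
             (limit-squareFreeFactor₂ (s ∘ suc)) 26≤p sq′
    sq″ : SquarePrefix (p / 13 * 13) (drop i image)
    sq″ = subst (λ p → SquarePrefix p (drop i image)) (sym (m/n*n≡m 13∣p)) sq′

limit-at-power : ∀ n s → limit s (13 ^ n) ≡ lookup (h (s n) 0F) 1F
limit-at-power zero    s = trans (limit-fixed s 1) (cong (λ a → lookup (h (s 0) a) 1F) (limit-head (s ∘ suc)))
limit-at-power (suc n) s = begin
  limit s (13 * 13 ^ n)                      ≡⟨ limit-fixed s (13 * 13 ^ n) ⟩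
  (σ ⟨ limit (s ∘ suc) ⟩) (13 * 13 ^ n)      ≡⟨ cong (σ ⟨ limit (s ∘ suc) ⟩) (block-start (13 ^ n)) ⟩
  (σ ⟨ limit (s ∘ suc) ⟩) (13 ^ n * 13 + 0)  ≡⟨ image-block σ (limit (s ∘ suc)) (13 ^ n) 0F ⟩
  lookup (σ (limit (s ∘ suc) (13 ^ n))) 0F   ≡⟨ h-first (s 0) _ ⟩
  limit (s ∘ suc) (13 ^ n)                   ≡⟨ limit-at-power n (s ∘ suc) ⟩
  lookup (h (s (suc n)) 0F) 1F               ∎
  where
  open ≡-Reasoning
  σ = h (s 0)
  block-start : ∀ q → 13 * q ≡ q * 13 + 0
  block-start = solve-∀

diagonal : (ℕ → InfWord) → ℕ → Bool
diagonal f n = does (f n (13 ^ n + 13 ^ n) ≟ᶠ 1F)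

h-second-letter-avoids : ∀ a → lookup (h (does (a ≟ᶠ 1F)) 0F) 1F ≢ a
h-second-letter-avoids 0F ()
h-second-letter-avoids 1F ()
h-second-letter-avoids 2F ()

proposition9 : Uncountable Good
proposition9 f =
  double (limit s) , (double-overlapFree (limit s) (limit-squareFree s) , double-squareConcat (limit s)) , apart
  where
  s = diagonal f
  apart : ∀ n → Apart (double (limit s)) (f n)
  apart n = 13 ^ n + 13 ^ n , λ eq → h-second-letter-avoids (f n (13 ^ n + 13 ^ n)) (begin
    lookup (h (s n) 0F) 1F                ≡⟨ sym (limit-at-power n s) ⟩
    limit s (13 ^ n)                      ≡⟨ sym (double-shift (limit s) 0 (13 ^ n)) ⟩
    double (limit s) (13 ^ n + 13 ^ n)    ≡⟨ eq ⟩
    f n (13 ^ n + 13 ^ n)                 ∎)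
    where open ≡-Reasoning
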